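{- Let $d \ge 1$, let $a_1, \dots, a_d$ be nonnegative integers, and let $\mathcal{F} = \{(A_i^{(1)}, \dots, A_i^{(d)}) \mid i \in [m]\}$ be a skew Bollobás system of $d$-tuples of finite sets such that $|A_i^{(p)}| = a_p$ for all $i \in [m]$ and $p \in [d]$. Then $$m \le \binom{a_1 + \cdots + a_d}{a_1, \dots, a_d}.$$
   Context: $\binom{a_1+\cdots+a_d}{a_1,\dots,a_d} = \frac{(a_1+\cdots+a_d)!}{a_1!\cdots a_d!}$ is the multinomial coefficient. A family $\mathcal{F} = \{(A_i^{(1)}, \dots, A_i^{(d)}) \mid i \in [m]\}$ of $d$-tuples of finite sets is a skew Bollobás system of $d$-tuples if $A_i^{(p)} \cap A_i^{(q)} = \emptyset$ for every $i \in [m]$ and $p \ne q$, and for any $i < j$ in $[m]$ there exist $p < q$ in $[d]$ with $A_i^{(p)} \cap A_j^{(q)} \ne \emptyset$. -}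

module Defs where

open import Data.Nat using (ℕ; zero; suc; _+_; _*_; _/_; NonZero)
open import Data.Nat.Properties using (m*n≢0)
open import Data.Nat using (_!)
open import Data.Nat.Properties using (_!≢0)
open import Data.Fin using (Fin; _<_)
open import Data.List using (List; length)
open import Data.List.Membership.Propositional using (_∈_)
open import Data.List.Relation.Unary.Unique.Propositional using (Unique)
open import Data.Product using (∃; ∃-syntax; _×_; Σ-syntax)
open import Relation.Nullary using (¬_)
open import Relation.Binary.PropositionalEquality using (_≢_)

sumFin : ∀ {d} → (Fin d → ℕ) → ℕ
sumFin {zero}  a = 0
sumFin {suc d} a = a Data.Fin.zero + sumFin (λ i → a (Data.Fin.suc i))

prodFact : ∀ {d} → (Fin d → ℕ) → ℕ
prodFact {zero}  a = 1
prodFact {suc d} a = (a Data.Fin.zero) ! * prodFact (λ i → a (Data.Fin.suc i))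

prodFact≢0 : ∀ {d} (a : Fin d → ℕ) → NonZero (prodFact a)
prodFact≢0 {zero}  a = _
prodFact≢0 {suc d} a =
  m*n≢0 ((a Data.Fin.zero) !) (prodFact (λ i → a (Data.Fin.suc i)))
    {{a Data.Fin.zero !≢0}} {{prodFact≢0 (λ i → a (Data.Fin.suc i))}}

multinomial : ∀ {d} → (Fin d → ℕ) → ℕ
multinomial a = _/_ ((sumFin a) !) (prodFact a) {{prodFact≢0 a}}

record FinSet (X : Set) : Set where
  constructor finset
  field
    elems  : List X
    unique : Unique elems
open FinSet public

_∈ₛ_ : {X : Set} → X → FinSet X → Set
x ∈ₛ A = x ∈ elems A

∣_∣ₛ : {X : Set} → FinSet X → ℕ
∣ A ∣ₛ = length (elems A)

Intersects : {X : Set} → FinSet X → FinSet X → Set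
Intersects A B = ∃[ x ] (x ∈ₛ A × x ∈ₛ B)

Disjoint : {X : Set} → FinSet X → FinSet X → Set
Disjoint A B = ¬ Intersects A B

-- A family indexed by [m], each member a d-tuple of finite sets: F i p = A_i^(p)
IsSkewBollobas : {X : Set} (m d : ℕ) → (Fin m → Fin d → FinSet X) → Set
IsSkewBollobas m d F =
  (∀ (i : Fin m) (p q : Fin d) → p ≢ q → Disjoint (F i p) (F i q)) ×
  (∀ (i j : Fin m) → i < j →
     Σ[ p ∈ Fin d ] Σ[ q ∈ Fin d ] (p < q × Intersects (F i p) (F j q)))

{-# OPTIONS --safe #-}
module Submission where

-- Label the ground elements by distinct integers and write sₚ = aₚ₊₁ + ⋯ + a_d. For a tuple
-- (A^(1), …, A^(d)), the map C ↦ ∏_{x ∈ A^(p)} C(x) on coefficient vectors of polynomials C of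
-- degree sₚ is a homogeneous polynomial of degree aₚ in sₚ + 1 variables, i.e. a vector in a
-- space of dimension binom(aₚ + sₚ, aₚ). Evaluated at the monic polynomial whose roots are the
-- elements of B^(p+1), …, B^(d) of a second tuple it gives ∏_{x ∈ A^(p)} ∏_{q > p, y ∈ B^(q)} (x − y).
-- Tensoring over p gives vectors uᵢ, vⱼ in ℤ^N, N = ∏ₚ binom(aₚ + sₚ, aₚ) = the multinomial
-- coefficient, with ⟨uᵢ, vⱼ⟩ = 0 for i < j (the family is skew) and ⟨uᵢ, vᵢ⟩ ≠ 0 (each tuple is
-- disjoint). Such a triangular system has at most N rows.

open import Defs
open import Data.Nat using (ℕ; _≤_; _≥_)
open import Data.Fin using (Fin)
open import Relation.Binary.PropositionalEquality using (_≡_)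

open import Data.Empty using (⊥-elim)
open import Data.Fin as Fin using (zero; suc; _<_; splitAt; _↑ˡ_; _↑ʳ_)
open import Data.Fin.Properties using (¬∀⟶∃¬; <⇒≢; cast-involutive)
open import Data.Integer as ℤ using (ℤ; 0ℤ; 1ℤ; _+_; _*_; -_; _-_; _≟_)
open import Data.Integer.Properties
  using ( +-*-semiring; *-1-monoid; +-identityˡ; +-identityʳ; +-assoc; *-identityˡ; *-identityʳ
        ; *-zeroʳ; *-assoc; i*j≡0⇒i≡0∨j≡0; i-j≡0⇒i≡j; i≡j⇒i-j≡0 )
open import Data.Integer.Tactic.RingSolver using (solve-∀)
open import Data.List as List using (List)
open import Data.List.Membership.Propositional using (_∈_)
open import Data.List.Membership.Propositional.Properties using (∈-concat⁺′; ∈-tabulate⁺; ∈-lookup)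
open import Data.List.Relation.Unary.All as All using (All)
open import Data.List.Relation.Unary.Any as Any using (here; there)
open import Data.List.Relation.Unary.Any.Properties using (lookup-index)
open import Data.Nat as ℕ using (zero; suc; z≤n; s≤s; _≤?_; _!)
open import Data.Nat.DivMod using (m*n/n≡m)
import Data.Nat.Properties as ℕ
import Data.Nat.Tactic.RingSolver as ℕ-Solver
open import Data.Product using (∃-syntax; Σ-syntax; _×_; _,_; proj₁; proj₂)
open import Data.Sum using (_⊎_; inj₁; inj₂)
open import Data.Unit using (⊤; tt)
open import Data.Vec.Functional using (Vector; []; _∷_; head; tail; map; zipWith; _++_; removeAt)
open import Data.Vec.Functional.Properties using (lookup-++ˡ; lookup-++ʳ)
open import Effect.Monad using (RawMonad)
open import Function using (_∘_)
open import Level using (0ℓ)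
open import Relation.Binary.PropositionalEquality
  using (_≢_; _≗_; refl; sym; trans; cong; cong₂; subst; module ≡-Reasoning)
open import Relation.Nullary using (¬_; Dec; yes; no)
open import Relation.Nullary.Decidable using (decidable-stable; ¬¬-excluded-middle)
open import Relation.Nullary.Negation using (¬¬-map; ¬¬-Monad)

open import Algebra.Properties.Semiring.Sum +-*-semiring
  using (sum; sum-cong-≗; sum-remove; ∑-distrib-+; *-distribˡ-sum; sum-replicate-zero)
open import Algebra.Properties.Monoid.Sum *-1-monoid
  using () renaming (sum to ∏; sum-cong-≗ to ∏-cong)

open ≡-Reasoning

infix  7 _·_
infixr 7 _⊗_

_·_ : ∀ {n} → Vector ℤ n → Vector ℤ n → ℤ
u · v = sum (zipWith _*_ u v)

·-zeroˡ : ∀ {n} (u v : Vector ℤ n) → (∀ i → u i ≡ 0ℤ) → u · v ≡ 0ℤ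
·-zeroˡ {n} u v u≡0 = trans (sum-cong-≗ (λ i → cong (_* v i) (u≡0 i))) (sum-replicate-zero n)

·-linearˡ : ∀ {n} x y (u w v : Vector ℤ n) →
            (λ i → x * u i + y * w i) · v ≡ x * (u · v) + y * (w · v)
·-linearˡ x y u w v = begin
  sum (λ i → (x * u i + y * w i) * v i)
    ≡⟨ sum-cong-≗ (λ i → distrib x y (u i) (w i) (v i)) ⟩
  sum (λ i → x * (u i * v i) + y * (w i * v i))
    ≡⟨ ∑-distrib-+ (λ i → x * (u i * v i)) (λ i → y * (w i * v i)) ⟩
  sum (λ i → x * (u i * v i)) + sum (λ i → y * (w i * v i))
    ≡⟨ sym (cong₂ _+_ (*-distribˡ-sum x (zipWith _*_ u v)) (*-distribˡ-sum y (zipWith _*_ w v))) ⟩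
  x * (u · v) + y * (w · v) ∎
  where
  distrib : ∀ x y a b c → (x * a + y * b) * c ≡ x * (a * c) + y * (b * c)
  distrib = solve-∀

·-scaleˡ : ∀ {n} x (u v : Vector ℤ n) → map (x *_) u · v ≡ x * (u · v)
·-scaleˡ x u v =
  trans (sum-cong-≗ (λ i → *-assoc x (u i) (v i))) (sym (*-distribˡ-sum x (zipWith _*_ u v)))

·-scaleʳ : ∀ {n} x (u v : Vector ℤ n) → u · map (x *_) v ≡ x * (u · v)
·-scaleʳ x u v =
  trans (sum-cong-≗ (λ i → swap x (u i) (v i))) (sym (*-distribˡ-sum x (zipWith _*_ u v)))
  where
  swap : ∀ x a b → a * (x * b) ≡ x * (a * b)
  swap = solve-∀

·-removeAt : ∀ {n} (u v : Vector ℤ (suc n)) k → u k ≡ 0ℤ →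
             removeAt u k · removeAt v k ≡ u · v
·-removeAt u v k uₖ≡0 = sym (begin
  u · v                                    ≡⟨ sum-remove {i = k} (zipWith _*_ u v) ⟩
  u k * v k + removeAt u k · removeAt v k  ≡⟨ cong (λ x → x * v k + removeAt u k · removeAt v k) uₖ≡0 ⟩
  0ℤ + removeAt u k · removeAt v k         ≡⟨ +-identityˡ _ ⟩
  removeAt u k · removeAt v k              ∎)

tail-++ : ∀ {A : Set} {m n} (u : Vector A (suc m)) (v : Vector A n) → tail (u ++ v) ≗ tail u ++ v
tail-++ {m = m} u v i with splitAt m i
... | inj₁ j = refl
... | inj₂ j = refl

zipWith-++ : ∀ {A B C : Set} {m n} (f : A → B → C) (u : Vector A m) (u′ : Vector B m)
             (v : Vector A n) (v′ : Vector B n) →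
             zipWith f (u ++ v) (u′ ++ v′) ≗ zipWith f u u′ ++ zipWith f v v′
zipWith-++ {m = m} f u u′ v v′ i with splitAt m i
... | inj₁ j = refl
... | inj₂ j = refl

++-lookup-cases : ∀ {A : Set} {m n} (u : Vector A m) (v : Vector A n) i →
                  (∃[ j ] (u ++ v) i ≡ u j) ⊎ (∃[ j ] (u ++ v) i ≡ v j)
++-lookup-cases {m = m} u v i with splitAt m i
... | inj₁ j = inj₁ (j , refl)
... | inj₂ j = inj₂ (j , refl)

sum-++ : ∀ {m n} (u : Vector ℤ m) (v : Vector ℤ n) → sum (u ++ v) ≡ sum u + sum v
sum-++ {zero}  u v = sym (+-identityˡ (sum v))
sum-++ {suc m} u v = begin
  head u + sum (tail (u ++ v))     ≡⟨ cong (head u +_) (sum-cong-≗ (tail-++ u v)) ⟩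
  head u + sum (tail u ++ v)       ≡⟨ cong (head u +_) (sum-++ (tail u) v) ⟩
  head u + (sum (tail u) + sum v)  ≡⟨ sym (+-assoc (head u) _ _) ⟩
  sum u + sum v                    ∎

·-++ : ∀ {m n} (u u′ : Vector ℤ m) (v v′ : Vector ℤ n) → (u ++ v) · (u′ ++ v′) ≡ u · u′ + v · v′
·-++ u u′ v v′ =
  trans (sum-cong-≗ (zipWith-++ _*_ u u′ v v′)) (sum-++ (zipWith _*_ u u′) (zipWith _*_ v v′))

_⊗_ : ∀ {m n} → Vector ℤ m → Vector ℤ n → Vector ℤ (m ℕ.* n)
_⊗_ {zero}  u v ()
_⊗_ {suc m} u v = map (head u *_) v ++ tail u ⊗ v

·-⊗ : ∀ {m n} (u u′ : Vector ℤ m) (v v′ : Vector ℤ n) → (u ⊗ v) · (u′ ⊗ v′) ≡ (u · u′) * (v · v′)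
·-⊗ {zero}  u u′ v v′ = refl
·-⊗ {suc m} u u′ v v′ = begin
  (map (head u *_) v ++ tail u ⊗ v) · (map (head u′ *_) v′ ++ tail u′ ⊗ v′)
    ≡⟨ ·-++ (map (head u *_) v) (map (head u′ *_) v′) (tail u ⊗ v) (tail u′ ⊗ v′) ⟩
  map (head u *_) v · map (head u′ *_) v′ + (tail u ⊗ v) · (tail u′ ⊗ v′)
    ≡⟨ cong₂ _+_ scaled (·-⊗ (tail u) (tail u′) v v′) ⟩
  head u * head u′ * (v · v′) + (tail u · tail u′) * (v · v′)
    ≡⟨ collect (head u * head u′) (tail u · tail u′) (v · v′) ⟩
  (u · u′) * (v · v′) ∎
  where
  rearrange : ∀ x y s → y * (x * s) ≡ x * y * s
  rearrange = solve-∀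
  collect : ∀ a b s → a * s + b * s ≡ (a + b) * s
  collect = solve-∀
  scaled : map (head u *_) v · map (head u′ *_) v′ ≡ head u * head u′ * (v · v′)
  scaled = begin
    map (head u *_) v · map (head u′ *_) v′  ≡⟨ ·-scaleʳ (head u′) (map (head u *_) v) v′ ⟩
    head u′ * (map (head u *_) v · v′)       ≡⟨ cong (head u′ *_) (·-scaleˡ (head u) v v′) ⟩
    head u′ * (head u * (v · v′))            ≡⟨ rearrange (head u) (head u′) (v · v′) ⟩
    head u * head u′ * (v · v′)              ∎

*-≢0 : ∀ {x y} → x ≢ 0ℤ → y ≢ 0ℤ → x * y ≢ 0ℤ
*-≢0 {x} x≢0 y≢0 xy≡0 with i*j≡0⇒i≡0∨j≡0 x xy≡0
... | inj₁ x≡0 = x≢0 x≡0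
... | inj₂ y≡0 = y≢0 y≡0

∏-≡0 : ∀ {n} (u : Vector ℤ n) k → u k ≡ 0ℤ → ∏ u ≡ 0ℤ
∏-≡0 u zero    uₖ≡0 = cong (_* ∏ (tail u)) uₖ≡0
∏-≡0 u (suc k) uₖ≡0 = trans (cong (head u *_) (∏-≡0 (tail u) k uₖ≡0)) (*-zeroʳ (head u))

∏-≢0 : ∀ {n} (u : Vector ℤ n) → (∀ k → u k ≢ 0ℤ) → ∏ u ≢ 0ℤ
∏-≢0 {zero}  u u≢0 ()
∏-≢0 {suc n} u u≢0 = *-≢0 (u≢0 zero) (∏-≢0 (tail u) (u≢0 ∘ suc))

nonzero-entry : ∀ {n} (u v : Vector ℤ n) → u · v ≢ 0ℤ → ∃[ k ] u k ≢ 0ℤ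
nonzero-entry {n} u v u·v≢0 =
  ¬∀⟶∃¬ n (λ k → u k ≡ 0ℤ) (λ k → u k ≟ 0ℤ) (λ u≡0 → u·v≢0 (·-zeroˡ u v u≡0))

-- Fraction-free Gaussian elimination: clearing the pivot column of the later rows of g with
-- the first row keeps the system triangular and removes one row and one column.
triangular⇒≤ : ∀ {m N} (g h : Fin m → Vector ℤ N) →
               (∀ {i j} → i < j → g i · h j ≡ 0ℤ) → (∀ i → g i · h i ≢ 0ℤ) → m ≤ N
triangular⇒≤ {zero}          g h _     _    = z≤n
triangular⇒≤ {suc m} {zero}  g h _     diag = ⊥-elim (diag zero refl)
triangular⇒≤ {suc m} {suc N} g h upper diag = s≤s (triangular⇒≤ g′ h′ upper′ diag′)
  where
  k : Fin (suc N)
  k = proj₁ (nonzero-entry (g zero) (h zero) (diag zero))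

  pivot : ℤ
  pivot = g zero k

  pivot≢0 : pivot ≢ 0ℤ
  pivot≢0 = proj₂ (nonzero-entry (g zero) (h zero) (diag zero))

  cleared : Fin m → Vector ℤ (suc N)
  cleared i c = pivot * g (suc i) c + (- g (suc i) k) * g zero c

  cleared-pivot : ∀ i → cleared i k ≡ 0ℤ
  cleared-pivot i = cancel pivot (g (suc i) k)
    where
    cancel : ∀ x y → x * y + (- y) * x ≡ 0ℤ
    cancel = solve-∀

  g′ h′ : Fin m → Vector ℤ N
  g′ i = removeAt (cleared i) k
  h′ j = removeAt (h (suc j)) k

  g′·h′ : ∀ i j → g′ i · h′ j ≡ pivot * (g (suc i) · h (suc j))
  g′·h′ i j = begin
    g′ i · h′ j
      ≡⟨ ·-removeAt (cleared i) (h (suc j)) k (cleared-pivot i) ⟩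
    cleared i · h (suc j)
      ≡⟨ ·-linearˡ pivot (- g (suc i) k) (g (suc i)) (g zero) (h (suc j)) ⟩
    pivot * (g (suc i) · h (suc j)) + (- g (suc i) k) * (g zero · h (suc j))
      ≡⟨ cong (λ x → pivot * (g (suc i) · h (suc j)) + (- g (suc i) k) * x) (upper (s≤s z≤n)) ⟩
    pivot * (g (suc i) · h (suc j)) + (- g (suc i) k) * 0ℤ
      ≡⟨ cong (pivot * (g (suc i) · h (suc j)) +_) (*-zeroʳ (- g (suc i) k)) ⟩
    pivot * (g (suc i) · h (suc j)) + 0ℤ
      ≡⟨ +-identityʳ _ ⟩
    pivot * (g (suc i) · h (suc j)) ∎

  upper′ : ∀ {i j} → i < j → g′ i · h′ j ≡ 0ℤ
  upper′ {i} {j} i<j =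
    trans (g′·h′ i j) (trans (cong (pivot *_) (upper (s≤s i<j))) (*-zeroʳ pivot))

  diag′ : ∀ i → g′ i · h′ i ≢ 0ℤ
  diag′ i g′·h′≡0 = *-≢0 pivot≢0 (diag (suc i)) (trans (sym (g′·h′ i i)) g′·h′≡0)

-- Hom a n: homogeneous polynomials of degree a in n variables. One of positive degree in
-- c₀, …, cₙ is stored as p(c₁, …, cₙ) + c₀ q(c₀, …, cₙ).
Hom : ℕ → ℕ → Set
Hom zero    n       = ℤ
Hom (suc a) zero    = ⊤
Hom (suc a) (suc n) = Hom (suc a) n × Hom a (suc n)

eval : ∀ {a n} → Hom a n → Vector ℤ n → ℤ
eval {zero}          k       c = k
eval {suc a} {zero}  _       c = 0ℤ
eval {suc a} {suc n} (p , q) c = eval p (tail c) + head c * eval q c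

0ᴴ : ∀ {a n} → Hom a n
0ᴴ {zero}          = 0ℤ
0ᴴ {suc a} {zero}  = tt
0ᴴ {suc a} {suc n} = 0ᴴ , 0ᴴ

infixl 6 _+ᴴ_
infixl 7 _*ᴴ_

_+ᴴ_ : ∀ {a n} → Hom a n → Hom a n → Hom a n
_+ᴴ_ {zero}          k       k′        = k + k′
_+ᴴ_ {suc a} {zero}  _       _         = tt
_+ᴴ_ {suc a} {suc n} (p , q) (p′ , q′) = p +ᴴ p′ , q +ᴴ q′

_*ᴴ_ : ∀ {a n} → ℤ → Hom a n → Hom a n
_*ᴴ_ {zero}          x k       = x * k
_*ᴴ_ {suc a} {zero}  x _       = tt
_*ᴴ_ {suc a} {suc n} x (p , q) = x *ᴴ p , x *ᴴ q

weaken : ∀ {a n} → Hom a n → Hom a (suc n)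
weaken {zero}  k = k
weaken {suc a} p = p , 0ᴴ

eval-0ᴴ : ∀ {a n} (c : Vector ℤ n) → eval (0ᴴ {a}) c ≡ 0ℤ
eval-0ᴴ {zero}          c = refl
eval-0ᴴ {suc a} {zero}  c = refl
eval-0ᴴ {suc a} {suc n} c = begin
  eval (0ᴴ {suc a} {n}) (tail c) + head c * eval (0ᴴ {a}) c
    ≡⟨ cong₂ (λ x y → x + head c * y) (eval-0ᴴ {suc a} (tail c)) (eval-0ᴴ {a} c) ⟩
  0ℤ + head c * 0ℤ
    ≡⟨ cong (0ℤ +_) (*-zeroʳ (head c)) ⟩
  0ℤ ∎

eval-+ᴴ : ∀ {a n} (p q : Hom a n) (c : Vector ℤ n) → eval (p +ᴴ q) c ≡ eval p c + eval q c
eval-+ᴴ {zero}          k       k′        c = refl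
eval-+ᴴ {suc a} {zero}  _       _         c = refl
eval-+ᴴ {suc a} {suc n} (p , q) (p′ , q′) c = begin
  eval (p +ᴴ p′) (tail c) + head c * eval (q +ᴴ q′) c
    ≡⟨ cong₂ (λ x y → x + head c * y) (eval-+ᴴ p p′ (tail c)) (eval-+ᴴ q q′ c) ⟩
  (eval p (tail c) + eval p′ (tail c)) + head c * (eval q c + eval q′ c)
    ≡⟨ regroup (eval p (tail c)) (eval p′ (tail c)) (head c) (eval q c) (eval q′ c) ⟩
  (eval p (tail c) + head c * eval q c) + (eval p′ (tail c) + head c * eval q′ c) ∎
  where
  regroup : ∀ s s′ x t t′ → (s + s′) + x * (t + t′) ≡ (s + x * t) + (s′ + x * t′)
  regroup = solve-∀

eval-*ᴴ : ∀ {a n} x (p : Hom a n) (c : Vector ℤ n) → eval (x *ᴴ p) c ≡ x * eval p c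
eval-*ᴴ {zero}          x k       c = refl
eval-*ᴴ {suc a} {zero}  x _       c = sym (*-zeroʳ x)
eval-*ᴴ {suc a} {suc n} x (p , q) c = begin
  eval (x *ᴴ p) (tail c) + head c * eval (x *ᴴ q) c
    ≡⟨ cong₂ (λ s t → s + head c * t) (eval-*ᴴ x p (tail c)) (eval-*ᴴ x q c) ⟩
  x * eval p (tail c) + head c * (x * eval q c)
    ≡⟨ factor x (eval p (tail c)) (head c) (eval q c) ⟩
  x * (eval p (tail c) + head c * eval q c) ∎
  where
  factor : ∀ x s y t → x * s + y * (x * t) ≡ x * (s + y * t)
  factor = solve-∀

eval-weaken : ∀ {a n} (p : Hom a n) (c : Vector ℤ (suc n)) → eval (weaken p) c ≡ eval p (tail c)
eval-weaken {zero}  k c = refl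
eval-weaken {suc a} p c = begin
  eval p (tail c) + head c * eval (0ᴴ {a}) c
    ≡⟨ cong (λ x → eval p (tail c) + head c * x) (eval-0ᴴ {a} c) ⟩
  eval p (tail c) + head c * 0ℤ
    ≡⟨ cong (eval p (tail c) +_) (*-zeroʳ (head c)) ⟩
  eval p (tail c) + 0ℤ
    ≡⟨ +-identityʳ _ ⟩
  eval p (tail c) ∎

-- (l₀ c₀ + l′ · c′) (p(c′) + c₀ q(c)) = (l′ · c′) p(c′) + c₀ (l₀ p(c′) + (l · c) q(c))
mul-linear : ∀ {a n} → Vector ℤ n → Hom a n → Hom (suc a) n
mul-linear {a}     {zero}  l _       = tt
mul-linear {zero}  {suc n} l k       = mul-linear (tail l) k , head l * k
mul-linear {suc a} {suc n} l (p , q) = mul-linear (tail l) p , head l *ᴴ weaken p +ᴴ mul-linear l q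

eval-mul-linear : ∀ {a n} (l : Vector ℤ n) (p : Hom a n) (c : Vector ℤ n) →
                  eval (mul-linear l p) c ≡ (l · c) * eval p c
eval-mul-linear {a}     {zero}  l _ c = refl
eval-mul-linear {zero}  {suc n} l k c = begin
  eval (mul-linear (tail l) k) (tail c) + head c * (head l * k)
    ≡⟨ cong (_+ head c * (head l * k)) (eval-mul-linear (tail l) k (tail c)) ⟩
  (tail l · tail c) * k + head c * (head l * k)
    ≡⟨ distrib (tail l · tail c) (head c) (head l) k ⟩
  (head l * head c + tail l · tail c) * k ∎
  where
  distrib : ∀ s x y k → s * k + x * (y * k) ≡ (y * x + s) * k
  distrib = solve-∀
eval-mul-linear {suc a} {suc n} l (p , q) c = begin
  eval (mul-linear (tail l) p) (tail c) + head c * eval (head l *ᴴ weaken p +ᴴ mul-linear l q) c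
    ≡⟨ cong₂ (λ s t → s + head c * t) (eval-mul-linear (tail l) p (tail c)) second ⟩
  (tail l · tail c) * eval p (tail c) + head c * (head l * eval p (tail c) + (l · c) * eval q c)
    ≡⟨ distrib (tail l · tail c) (eval p (tail c)) (head c) (head l) (eval q c) ⟩
  (head l * head c + tail l · tail c) * (eval p (tail c) + head c * eval q c) ∎
  where
  distrib : ∀ s e x y f → s * e + x * (y * e + (y * x + s) * f) ≡ (y * x + s) * (e + x * f)
  distrib = solve-∀
  second : eval (head l *ᴴ weaken p +ᴴ mul-linear l q) c
           ≡ head l * eval p (tail c) + (l · c) * eval q c
  second = begin
    eval (head l *ᴴ weaken p +ᴴ mul-linear l q) c
      ≡⟨ eval-+ᴴ (head l *ᴴ weaken p) (mul-linear l q) c ⟩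
    eval (head l *ᴴ weaken p) c + eval (mul-linear l q) c
      ≡⟨ cong₂ _+_ (trans (eval-*ᴴ (head l) (weaken p) c) (cong (head l *_) (eval-weaken p c)))
                   (eval-mul-linear l q c) ⟩
    head l * eval p (tail c) + (l · c) * eval q c ∎

dim : ℕ → ℕ → ℕ
dim zero    n       = 1
dim (suc a) zero    = 0
dim (suc a) (suc n) = dim (suc a) n ℕ.+ dim a (suc n)

coefficients : ∀ {a n} → Hom a n → Vector ℤ (dim a n)
coefficients {zero}          k       = k ∷ []
coefficients {suc a} {zero}  _       = []
coefficients {suc a} {suc n} (p , q) = coefficients p ++ coefficients q

monomials : ∀ {a n} → Vector ℤ n → Vector ℤ (dim a n)
monomials {zero}          c = 1ℤ ∷ []
monomials {suc a} {zero}  c = []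
monomials {suc a} {suc n} c = monomials {suc a} (tail c) ++ map (head c *_) (monomials {a} c)

eval≡coefficients·monomials : ∀ {a n} (p : Hom a n) (c : Vector ℤ n) →
                              eval p c ≡ coefficients p · monomials {a} c
eval≡coefficients·monomials {zero}          k       c =
  sym (trans (+-identityʳ (k * 1ℤ)) (*-identityʳ k))
eval≡coefficients·monomials {suc a} {zero}  _       c = refl
eval≡coefficients·monomials {suc a} {suc n} (p , q) c = begin
  eval p (tail c) + head c * eval q c
    ≡⟨ cong₂ (λ x y → x + head c * y) (eval≡coefficients·monomials p (tail c))
                                      (eval≡coefficients·monomials q c) ⟩
  coefficients p · monomials {suc a} (tail c) + head c * (coefficients q · monomials {a} c)
    ≡⟨ cong (coefficients p · monomials {suc a} (tail c) +_)
            (sym (·-scaleʳ (head c) (coefficients q) (monomials {a} c))) ⟩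
  coefficients p · monomials {suc a} (tail c) + coefficients q · map (head c *_) (monomials {a} c)
    ≡⟨ sym (·-++ (coefficients p) (monomials {suc a} (tail c))
                 (coefficients q) (map (head c *_) (monomials {a} c))) ⟩
  coefficients (p , q) · monomials {suc a} c ∎

dim-one : ∀ a → dim a 1 ≡ 1
dim-one zero    = refl
dim-one (suc a) = dim-one a

dim-factorial : ∀ a s → dim a (suc s) ℕ.* (a ! ℕ.* s !) ≡ (a ℕ.+ s) !
dim-factorial zero    s       = trans (ℕ.*-identityˡ _) (ℕ.*-identityˡ (s !))
dim-factorial (suc a) zero    = begin
  dim a 1 ℕ.* (suc a ! ℕ.* 1)  ≡⟨ cong (ℕ._* (suc a ! ℕ.* 1)) (dim-one a) ⟩
  1 ℕ.* (suc a ! ℕ.* 1)        ≡⟨ trans (ℕ.*-identityˡ _) (ℕ.*-identityʳ (suc a !)) ⟩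
  suc a !                      ≡⟨ cong _! (sym (ℕ.+-identityʳ (suc a))) ⟩
  (suc a ℕ.+ 0) !              ∎
dim-factorial (suc a) (suc s) = begin
  (dim (suc a) (suc s) ℕ.+ dim a (suc (suc s))) ℕ.* (suc a ! ℕ.* suc s !)
    ≡⟨ split (dim (suc a) (suc s)) (dim a (suc (suc s))) a s (a !) (s !) ⟩
  suc s ℕ.* (dim (suc a) (suc s) ℕ.* (suc a ! ℕ.* s !))
    ℕ.+ suc a ℕ.* (dim a (suc (suc s)) ℕ.* (a ! ℕ.* suc s !))
    ≡⟨ cong₂ (λ x y → suc s ℕ.* x ℕ.+ suc a ℕ.* y) (dim-factorial (suc a) s) (dim-factorial a (suc s)) ⟩
  suc s ℕ.* (suc a ℕ.+ s) ! ℕ.+ suc a ℕ.* (a ℕ.+ suc s) !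
    ≡⟨ cong (λ n → suc s ℕ.* n ! ℕ.+ suc a ℕ.* (a ℕ.+ suc s) !) (sym (ℕ.+-suc a s)) ⟩
  suc s ℕ.* (a ℕ.+ suc s) ! ℕ.+ suc a ℕ.* (a ℕ.+ suc s) !
    ≡⟨ collect a s ((a ℕ.+ suc s) !) ⟩
  (suc a ℕ.+ suc s) ! ∎
  where
  split : ∀ D₁ D₂ a s fa fs → (D₁ ℕ.+ D₂) ℕ.* (suc a ℕ.* fa ℕ.* (suc s ℕ.* fs))
          ≡ suc s ℕ.* (D₁ ℕ.* (suc a ℕ.* fa ℕ.* fs)) ℕ.+ suc a ℕ.* (D₂ ℕ.* (fa ℕ.* (suc s ℕ.* fs)))
  split = ℕ-Solver.solve-∀
  collect : ∀ a s f → suc s ℕ.* f ℕ.+ suc a ℕ.* f ≡ f ℕ.+ (a ℕ.+ suc s) ℕ.* f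
  collect = ℕ-Solver.solve-∀

powers : ∀ n → ℤ → Vector ℤ n
powers zero    x = []
powers (suc n) x = 1ℤ ∷ map (x *_) (powers n x)

powers-· : ∀ {n} x (c : Vector ℤ (suc n)) →
           powers (suc n) x · c ≡ head c + x * (powers n x · tail c)
powers-· {n} x c = cong₂ _+_ (*-identityˡ (head c)) (·-scaleˡ x (powers n x) (tail c))

-- the coefficients, lowest degree first, of (X - y) C(X), where C has coefficients c
mul-X-minus : ∀ {n} → ℤ → Vector ℤ n → Vector ℤ (suc n)
mul-X-minus {zero}  y c = 0ℤ ∷ []
mul-X-minus {suc n} y c = - (y * head c) ∷ (head c + head r ∷ tail r)
  where
  r : Vector ℤ (suc n)
  r = mul-X-minus y (tail c)

powers-·-mul-X-minus : ∀ {n} x y (c : Vector ℤ n) →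
                       powers (suc n) x · mul-X-minus y c ≡ (x - y) * (powers n x · c)
powers-·-mul-X-minus {zero}  x y c = sym (*-zeroʳ (x - y))
powers-·-mul-X-minus {suc n} x y c = begin
  powers (suc (suc n)) x · mul-X-minus y c
    ≡⟨ powers-· x (mul-X-minus y c) ⟩
  - (y * head c) + x * (powers (suc n) x · (head c + head r ∷ tail r))
    ≡⟨ cong (λ t → - (y * head c) + x * t) shifted ⟩
  - (y * head c) + x * (head c + (x - y) * (powers n x · tail c))
    ≡⟨ factor x y (head c) (powers n x · tail c) ⟩
  (x - y) * (head c + x * (powers n x · tail c))
    ≡⟨ cong ((x - y) *_) (sym (powers-· x c)) ⟩
  (x - y) * (powers (suc n) x · c) ∎
  where
  r : Vector ℤ (suc n)
  r = mul-X-minus y (tail c)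
  factor : ∀ x y c₀ t → - (y * c₀) + x * (c₀ + (x - y) * t) ≡ (x - y) * (c₀ + x * t)
  factor = solve-∀
  shifted : powers (suc n) x · (head c + head r ∷ tail r) ≡ head c + (x - y) * (powers n x · tail c)
  shifted = begin
    powers (suc n) x · (head c + head r ∷ tail r)  ≡⟨ powers-· x (head c + head r ∷ tail r) ⟩
    head c + head r + x * (powers n x · tail r)    ≡⟨ +-assoc (head c) (head r) _ ⟩
    head c + (head r + x * (powers n x · tail r))  ≡⟨ cong (head c +_) (sym (powers-· x r)) ⟩
    head c + powers (suc n) x · r                  ≡⟨ cong (head c +_) (powers-·-mul-X-minus x y (tail c)) ⟩
    head c + (x - y) * (powers n x · tail c)       ∎

monic-with-roots : ∀ {s} → Vector ℤ s → Vector ℤ (suc s)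
monic-with-roots {zero}  ys = 1ℤ ∷ []
monic-with-roots {suc s} ys = mul-X-minus (head ys) (monic-with-roots (tail ys))

powers-·-monic-with-roots : ∀ {s} x (ys : Vector ℤ s) →
                            powers (suc s) x · monic-with-roots ys ≡ ∏ (λ l → x - ys l)
powers-·-monic-with-roots {zero}  x ys = refl
powers-·-monic-with-roots {suc s} x ys =
  trans (powers-·-mul-X-minus x (head ys) (monic-with-roots (tail ys)))
        (cong ((x - head ys) *_) (powers-·-monic-with-roots x (tail ys)))

-- c ↦ ∏ₖ C(xₖ), where C is the polynomial with coefficient vector c
product-of-values : ∀ {a} n → Vector ℤ a → Hom a n
product-of-values {zero}  n xs = 1ℤ
product-of-values {suc a} n xs = mul-linear (powers n (head xs)) (product-of-values n (tail xs))

eval-product-of-values : ∀ {a n} (xs : Vector ℤ a) (c : Vector ℤ n) →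
                         eval (product-of-values n xs) c ≡ ∏ (λ k → powers n (xs k) · c)
eval-product-of-values {zero}      xs c = refl
eval-product-of-values {suc a} {n} xs c =
  trans (eval-mul-linear (powers n (head xs)) (product-of-values n (tail xs)) c)
        (cong ((powers n (head xs) · c) *_) (eval-product-of-values (tail xs) c))

resultant : ∀ {a s} → Vector ℤ a → Vector ℤ s → ℤ
resultant xs ys = ∏ (λ k → ∏ (λ l → xs k - ys l))

coefficients·monomials≡resultant :
  ∀ {a s} (xs : Vector ℤ a) (ys : Vector ℤ s) →
  coefficients (product-of-values (suc s) xs) · monomials {a} (monic-with-roots ys) ≡ resultant xs ys
coefficients·monomials≡resultant {a} {s} xs ys = begin
  coefficients (product-of-values (suc s) xs) · monomials {a} (monic-with-roots ys)
    ≡⟨ sym (eval≡coefficients·monomials (product-of-values (suc s) xs) (monic-with-roots ys)) ⟩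
  eval (product-of-values (suc s) xs) (monic-with-roots ys)
    ≡⟨ eval-product-of-values xs (monic-with-roots ys) ⟩
  ∏ (λ k → powers (suc s) (xs k) · monic-with-roots ys)
    ≡⟨ ∏-cong (λ k → powers-·-monic-with-roots (xs k) ys) ⟩
  resultant xs ys ∎

Labelling : ∀ {d} → (Fin d → ℕ) → Set
Labelling {d} a = (p : Fin d) → Vector ℤ (a p)

Separated : ∀ {d} {a : Fin d → ℕ} → Labelling a → Set
Separated {d} {a} t = ∀ {p q} → p < q → ∀ k l → t p k ≢ t q l

SkewMeets : ∀ {d} {a : Fin d → ℕ} → Labelling a → Labelling a → Set
SkewMeets {d} {a} t t′ = ∃[ p ] ∃[ q ] (p < q × ∃[ k ] ∃[ l ] t p k ≡ t′ q l)

concatenation : ∀ {d} {a : Fin d → ℕ} → Labelling a → Vector ℤ (sumFin a)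
concatenation {zero}  t = []
concatenation {suc d} t = t zero ++ concatenation (t ∘ suc)

concatenation-⊇ : ∀ {d} {a : Fin d → ℕ} (t : Labelling a) q l → ∃[ l′ ] concatenation t l′ ≡ t q l
concatenation-⊇ {suc d} {a} t zero    l = l ↑ˡ _ , lookup-++ˡ (t zero) (concatenation (t ∘ suc)) l
concatenation-⊇ {suc d} {a} t (suc q) l with concatenation-⊇ (t ∘ suc) q l
... | l′ , eq = a zero ↑ʳ l′ , trans (lookup-++ʳ (t zero) (concatenation (t ∘ suc)) l′) eq

concatenation-⊆ : ∀ {d} {a : Fin d → ℕ} (t : Labelling a) l′ →
                  ∃[ q ] ∃[ l ] concatenation t l′ ≡ t q l
concatenation-⊆ {suc d} t l′ with ++-lookup-cases (t zero) (concatenation (t ∘ suc)) l′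
... | inj₁ (l , eq)  = zero , l , eq
... | inj₂ (l″ , eq) with concatenation-⊆ (t ∘ suc) l″
...   | q , l , eq′ = suc q , l , trans eq eq′

-- ∏ₚ ∏ₖ ∏_{q > p} ∏ₗ (t p k - t′ q l)
cross : ∀ {d} {a : Fin d → ℕ} → Labelling a → Labelling a → ℤ
cross {zero}  t t′ = 1ℤ
cross {suc d} t t′ = resultant (t zero) (concatenation (t′ ∘ suc)) * cross (t ∘ suc) (t′ ∘ suc)

cross-≡0 : ∀ {d} {a : Fin d → ℕ} (t t′ : Labelling a) → SkewMeets t t′ → cross t t′ ≡ 0ℤ
cross-≡0 {suc d} t t′ (zero , suc q , _ , k , l , tₖ≡t′ₗ) with concatenation-⊇ (t′ ∘ suc) q l
... | l′ , eq = cong (_* cross (t ∘ suc) (t′ ∘ suc))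
                     (∏-≡0 _ k (∏-≡0 _ l′ (i≡j⇒i-j≡0 (trans tₖ≡t′ₗ (sym eq)))))
cross-≡0 {suc d} t t′ (suc p , suc q , s≤s p<q , k , l , tₖ≡t′ₗ) =
  trans (cong (R *_) (cross-≡0 (t ∘ suc) (t′ ∘ suc) (p , q , p<q , k , l , tₖ≡t′ₗ))) (*-zeroʳ R)
  where
  R : ℤ
  R = resultant (t zero) (concatenation (t′ ∘ suc))

cross-≢0 : ∀ {d} {a : Fin d → ℕ} (t : Labelling a) → Separated t → cross t t ≢ 0ℤ
cross-≢0 {zero}  t separated ()
cross-≢0 {suc d} t separated =
  *-≢0 (∏-≢0 _ λ k → ∏-≢0 _ λ l′ → first-apart k l′) (cross-≢0 (t ∘ suc) (separated ∘ s≤s))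
  where
  first-apart : ∀ k l′ → t zero k - concatenation (t ∘ suc) l′ ≢ 0ℤ
  first-apart k l′ difference≡0 with concatenation-⊆ (t ∘ suc) l′
  ... | q , l , eq = separated (s≤s z≤n) k l (trans (i-j≡0⇒i≡j _ _ difference≡0) eq)

tensor-dim : ∀ {d} → (Fin d → ℕ) → ℕ
tensor-dim {zero}  a = 1
tensor-dim {suc d} a = dim (a zero) (suc (sumFin (a ∘ suc))) ℕ.* tensor-dim (a ∘ suc)

left-vector : ∀ {d} {a : Fin d → ℕ} → Labelling a → Vector ℤ (tensor-dim a)
left-vector {zero}      t = 1ℤ ∷ []
left-vector {suc d} {a} t =
  coefficients (product-of-values (suc (sumFin (a ∘ suc))) (t zero)) ⊗ left-vector (t ∘ suc)

right-vector : ∀ {d} {a : Fin d → ℕ} → Labelling a → Vector ℤ (tensor-dim a)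
right-vector {zero}      t′ = 1ℤ ∷ []
right-vector {suc d} {a} t′ =
  monomials {a zero} (monic-with-roots (concatenation (t′ ∘ suc))) ⊗ right-vector (t′ ∘ suc)

left·right : ∀ {d} {a : Fin d → ℕ} (t t′ : Labelling a) →
             left-vector t · right-vector t′ ≡ cross t t′
left·right {zero}      t t′ = refl
left·right {suc d} {a} t t′ = begin
  left-vector t · right-vector t′
    ≡⟨ ·-⊗ u v (left-vector (t ∘ suc)) (right-vector (t′ ∘ suc)) ⟩
  (u · v) * (left-vector (t ∘ suc) · right-vector (t′ ∘ suc))
    ≡⟨ cong₂ _*_ (coefficients·monomials≡resultant (t zero) (concatenation (t′ ∘ suc)))
                 (left·right (t ∘ suc) (t′ ∘ suc)) ⟩
  cross t t′ ∎
  where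
  u v : Vector ℤ (dim (a zero) (suc (sumFin (a ∘ suc))))
  u = coefficients (product-of-values _ (t zero))
  v = monomials {a zero} (monic-with-roots (concatenation (t′ ∘ suc)))

labelled-bound : ∀ {d m} {a : Fin d → ℕ} (t : Fin m → Labelling a) →
                 (∀ i → Separated (t i)) → (∀ {i j} → i < j → SkewMeets (t i) (t j)) →
                 m ≤ tensor-dim a
labelled-bound t separated meets = triangular⇒≤ (left-vector ∘ t) (right-vector ∘ t)
  (λ {i} {j} i<j → trans (left·right (t i) (t j)) (cross-≡0 (t i) (t j) (meets i<j)))
  (λ i eq → cross-≢0 (t i) (separated i) (trans (sym (left·right (t i) (t i))) eq))

tensor-dim*prodFact : ∀ {d} (a : Fin d → ℕ) → tensor-dim a ℕ.* prodFact a ≡ sumFin a !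
tensor-dim*prodFact {zero}  a = refl
tensor-dim*prodFact {suc d} a = begin
  D ℕ.* T ℕ.* (a zero ! ℕ.* prodFact (a ∘ suc))
    ≡⟨ swap D T (a zero !) (prodFact (a ∘ suc)) ⟩
  D ℕ.* (a zero ! ℕ.* (T ℕ.* prodFact (a ∘ suc)))
    ≡⟨ cong (λ n → D ℕ.* (a zero ! ℕ.* n)) (tensor-dim*prodFact (a ∘ suc)) ⟩
  D ℕ.* (a zero ! ℕ.* sumFin (a ∘ suc) !)
    ≡⟨ dim-factorial (a zero) (sumFin (a ∘ suc)) ⟩
  sumFin a ! ∎
  where
  D T : ℕ
  D = dim (a zero) (suc (sumFin (a ∘ suc)))
  T = tensor-dim (a ∘ suc)
  swap : ∀ D T f P → D ℕ.* T ℕ.* (f ℕ.* P) ≡ D ℕ.* (f ℕ.* (T ℕ.* P))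
  swap = ℕ-Solver.solve-∀

tensor-dim≡multinomial : ∀ {d} (a : Fin d → ℕ) → tensor-dim a ≡ multinomial a
tensor-dim≡multinomial a = begin
  tensor-dim a                                  ≡⟨ sym (m*n/n≡m (tensor-dim a) (prodFact a)) ⟩
  (tensor-dim a ℕ.* prodFact a) ℕ./ prodFact a  ≡⟨ cong (ℕ._/ prodFact a) (tensor-dim*prodFact a) ⟩
  multinomial a                                 ∎
  where instance _ = prodFact≢0 a

module _ {X : Set} where

  DecidableOn : List X → Set
  DecidableOn L = ∀ {x y} → x ∈ L → y ∈ L → Dec (x ≡ y)

  -- Equality on X need not be decidable, but on a finite list it is up to double negation,
  -- which suffices because the conclusion m ≤ N is decidable.
  ¬¬-decidableOn : ∀ L → ¬ ¬ DecidableOn L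
  ¬¬-decidableOn L = ¬¬-map toDecidableOn (¬¬-all λ _ → ¬¬-all λ _ → ¬¬-excluded-middle)
    where
    ¬¬-all : ∀ {P : X → Set} → (∀ {x} → x ∈ L → ¬ ¬ P x) → ¬ ¬ All P L
    ¬¬-all f = All.sequenceA 0ℓ (RawMonad.rawApplicative ¬¬-Monad) (All.tabulate f)
    toDecidableOn : All (λ x → All (λ y → Dec (x ≡ y)) L) L → DecidableOn L
    toDecidableOn decisions x∈ y∈ = All.lookup (All.lookup decisions x∈) y∈

  restrict : ∀ {z L} → DecidableOn (z List.∷ L) → DecidableOn L
  restrict dec x∈ y∈ = dec (there x∈) (there y∈)

  first-index : ∀ {L} → DecidableOn L → ∀ {x} → x ∈ L → ℕ
  first-index {z List.∷ L} dec x∈ with dec x∈ (here refl)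
  ... | yes _   = 0
  ... | no x≢z = suc (first-index (restrict dec) (Any.tail x≢z x∈))

  first-index-injective : ∀ {L} (dec : DecidableOn L) {x y} (x∈ : x ∈ L) (y∈ : y ∈ L) →
                          first-index dec x∈ ≡ first-index dec y∈ → x ≡ y
  first-index-injective {z List.∷ L} dec x∈ y∈ eq with dec x∈ (here refl) | dec y∈ (here refl)
  ... | yes x≡z | yes y≡z = trans x≡z (sym y≡z)
  ... | yes _   | no _    = ⊥-elim (ℕ.0≢1+n eq)
  ... | no _    | yes _   = ⊥-elim (ℕ.1+n≢0 eq)
  ... | no x≢z  | no y≢z  =
    first-index-injective (restrict dec) (Any.tail x≢z x∈) (Any.tail y≢z y∈) (ℕ.suc-injective eq)

  first-index-cong : ∀ {L} (dec : DecidableOn L) {x y} → x ≡ y → (x∈ : x ∈ L) (y∈ : y ∈ L) →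
                     first-index dec x∈ ≡ first-index dec y∈
  first-index-cong {z List.∷ L} dec refl x∈ y∈ with dec x∈ (here refl) | dec y∈ (here refl)
  ... | yes _   | yes _   = refl
  ... | yes x≡z | no x≢z  = ⊥-elim (x≢z x≡z)
  ... | no x≢z  | yes x≡z = ⊥-elim (x≢z x≡z)
  ... | no x≢z  | no x≢z′ =
    cong suc (first-index-cong (restrict dec) refl (Any.tail x≢z x∈) (Any.tail x≢z′ y∈))

module FamilyLabelling {X : Set} {d m} {a : Fin d → ℕ}
                       (F : Fin m → Fin d → FinSet X) (sizes : ∀ i p → ∣ F i p ∣ₛ ≡ a p) where

  ground : List X
  ground = List.concat (List.tabulate λ i → List.concat (List.tabulate λ p → elems (F i p)))

  ∈-ground : ∀ {i p x} → x ∈ₛ F i p → x ∈ ground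
  ∈-ground {i} {p} x∈ = ∈-concat⁺′ (∈-concat⁺′ x∈ (∈-tabulate⁺ p)) (∈-tabulate⁺ i)

  element : ∀ i p → Fin (a p) → X
  element i p k = List.lookup (elems (F i p)) (Fin.cast (sym (sizes i p)) k)

  element-∈ : ∀ i p k → element i p k ∈ₛ F i p
  element-∈ i p k = ∈-lookup (Fin.cast (sym (sizes i p)) k)

  position : ∀ {i p x} → x ∈ₛ F i p → Fin (a p)
  position {i} {p} x∈ = Fin.cast (sizes i p) (Any.index x∈)

  element-position : ∀ {i p x} (x∈ : x ∈ₛ F i p) → element i p (position x∈) ≡ x
  element-position {i} {p} {x} x∈ = begin
    List.lookup (elems (F i p)) (Fin.cast (sym (sizes i p)) (Fin.cast (sizes i p) (Any.index x∈)))
      ≡⟨ cong (List.lookup (elems (F i p)))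
              (cast-involutive (sym (sizes i p)) (sizes i p) (Any.index x∈)) ⟩
    List.lookup (elems (F i p)) (Any.index x∈)
      ≡⟨ sym (lookup-index x∈) ⟩
    x ∎

  module _ (dec : DecidableOn ground) where

    label : Fin m → Labelling a
    label i p k = ℤ.+ first-index dec (∈-ground (element-∈ i p k))

    label-separated : (∀ i p q → p ≢ q → Disjoint (F i p) (F i q)) → ∀ i → Separated (label i)
    label-separated disjoint i {p} {q} p<q k l same-label =
      disjoint i p q (<⇒≢ p<q)
        (element i p k , element-∈ i p k , subst (_∈ₛ F i q) (sym same-element) (element-∈ i q l))
      where
      same-element : element i p k ≡ element i q l
      same-element = first-index-injective dec _ _ (cong ℤ.∣_∣ same-label)

    label-skew : (∀ i j → i < j →
                    Σ[ p ∈ Fin d ] Σ[ q ∈ Fin d ] (p < q × Intersects (F i p) (F j q))) →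
                 ∀ {i j} → i < j → SkewMeets (label i) (label j)
    label-skew skew {i} {j} i<j with skew i j i<j
    ... | p , q , p<q , x , x∈A , x∈B =
      p , q , p<q , position x∈A , position x∈B ,
      cong ℤ.+_ (first-index-cong dec (trans (element-position x∈A) (sym (element-position x∈B)))
                                  (∈-ground (element-∈ i p _)) (∈-ground (element-∈ j q _)))

open FamilyLabelling using (ground; label; label-separated; label-skew)

theorem1p9 : (X : Set) (d : ℕ) → d ≥ 1 → (a : Fin d → ℕ) (m : ℕ)
    → (F : Fin m → Fin d → FinSet X)
    → IsSkewBollobas m d F
    → (∀ (i : Fin m) (p : Fin d) → ∣ F i p ∣ₛ ≡ a p)
    → m ≤ multinomial a
theorem1p9 X d _ a m F (disjoint , skew) sizes =
  decidable-stable (m ≤? multinomial a) λ m≰multinomial →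
    ¬¬-decidableOn (ground F sizes) λ dec →
      m≰multinomial (subst (m ≤_) (tensor-dim≡multinomial a)
        (labelled-bound (label F sizes dec) (label-separated F sizes dec disjoint)
                        (label-skew F sizes dec skew)))
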